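{- Let $\mathcal{S}=(E,\mathcal{I})$ and $\mathcal{S}'=(E',\mathcal{I}')$ be similar $r$-covering systems with activities $\texttt{a}$ and $\texttt{a}'$ respectively. Then the activity vectors of $\texttt{a}$ and $\texttt{a}'$ are equal.
   Context: For finite sets $X\subseteq Y$, write $[X,Y]=\{Z : X\subseteq Z\subseteq Y\}$. An $r$-covering system is a pair $\mathcal{S}=(E,\mathcal{I})$ with $E$ a finite set and $\mathcal{I}$ a collection of subsets of $E$, each of cardinality at most $r$, such that for every $I\in\mathcal{I}$ there is an $r$-element set $B\in\mathcal{I}$ with $[I,B]\subseteq\mathcal{I}$. The $r$-element sets in $\mathcal{I}$ are called bases, $\mathcal{B}$ is the set of bases. An activity is a function $\texttt{a}:\mathcal{B}\to 2^E$ with $\texttt{a}(B)\subseteq B$, $[B\setminus\texttt{a}(B),B]\subseteq\mathcal{I}$ for all $B\in\mathcal{B}$, and such that every $I\in\mathcal{I}$ lies in $[B\setminus\texttt{a}(B),B]$ for exactly one $B\in\mathcal{B}$. The activity vector of $\texttt{a}$ is $(a_0,\dots,a_r)$, where $a_i$ is the number of bases $B$ with $|\texttt{a}(B)|=i$. Two $r$-covering systems $(E_1,\mathcal{I}_1)$ and $(E_2,\mathcal{I}_2)$ with $|E_1|=|E_2|$ are similar if there is a bijection $\psi:\mathcal{I}_1\to\mathcal{I}_2$ with $|\psi(X)|=|X|$ for every $X\in\mathcal{I}_1$. -}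

module Defs where

open import Data.Nat using (ℕ; zero; suc; _≤_; _≡ᵇ_)
open import Data.Bool using (Bool; true; false; T; _∧_; if_then_else_)
open import Data.Fin using (Fin)
open import Data.Fin.Subset using (Subset; _⊆_; _─_; ∣_∣)
open import Data.Vec using (_∷_; [])
open import Data.List using (List; []; _∷_; map; _++_; length; filterᵇ)
open import Data.Product using (Σ; proj₁; _×_; ∃; ∃-syntax)
open import Relation.Binary.PropositionalEquality using (_≡_)
open import Function.Bundles using (Bijection; _⤖_)

-- Ground set E is identified with Fin n.
-- A collection 𝓘 of subsets of Fin n is given by its (Boolean) membership
-- function; X ∈ 𝓘 means T (𝓘 X).
Collection : ℕ → Set
Collection n = Subset n → Bool

_∈𝓘_ : ∀ {n} → Subset n → Collection n → Set
X ∈𝓘 𝓘 = T (𝓘 X)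

_∈[_,_] : ∀ {n} → Subset n → Subset n → Subset n → Set
Z ∈[ X , Y ] = (X ⊆ Z) × (Z ⊆ Y)

IntervalIn : ∀ {n} → Subset n → Subset n → Collection n → Set
IntervalIn X Y 𝓘 = ∀ Z → Z ∈[ X , Y ] → Z ∈𝓘 𝓘

IsBasis : ∀ {n} → ℕ → Collection n → Subset n → Set
IsBasis r 𝓘 B = B ∈𝓘 𝓘 × ∣ B ∣ ≡ r

record IsCoveringSystem (r : ℕ) {n : ℕ} (𝓘 : Collection n) : Set where
  field
    card-≤ : ∀ I → I ∈𝓘 𝓘 → ∣ I ∣ ≤ r
    cover  : ∀ I → I ∈𝓘 𝓘 → ∃[ B ] (IsBasis r 𝓘 B × IntervalIn I B 𝓘)

-- Activity a : 𝓑 → 2^E (given as a function on all subsets; only its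
-- values on bases matter).
record IsActivity (r : ℕ) {n : ℕ} (𝓘 : Collection n) (a : Subset n → Subset n) : Set where
  field
    sub      : ∀ B → IsBasis r 𝓘 B → a B ⊆ B
    interval : ∀ B → IsBasis r 𝓘 B → IntervalIn (B ─ a B) B 𝓘
    unique   : ∀ I → I ∈𝓘 𝓘 →
               ∃[ B ] (IsBasis r 𝓘 B × I ∈[ B ─ a B , B ]
                       × (∀ B' → IsBasis r 𝓘 B' → I ∈[ B' ─ a B' , B' ] → B' ≡ B))

allSubsets : (n : ℕ) → List (Subset n)
allSubsets zero = [] ∷ []
allSubsets (suc n) = map (true ∷_) (allSubsets n) ++ map (false ∷_) (allSubsets n)

isBasisᵇ : ∀ {n} → ℕ → Collection n → Subset n → Bool
isBasisᵇ r 𝓘 B = 𝓘 B ∧ (∣ B ∣ ≡ᵇ r)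

activityCount : ∀ {n} → ℕ → Collection n → (Subset n → Subset n) → ℕ → ℕ
activityCount {n} r 𝓘 a i =
  length (filterᵇ (λ B → isBasisᵇ r 𝓘 B ∧ (∣ a B ∣ ≡ᵇ i)) (allSubsets n))

Members : ∀ {n} → Collection n → Set
Members {n} 𝓘 = Σ (Subset n) (λ X → X ∈𝓘 𝓘)

Similar : ∀ {n} → Collection n → Collection n → Set
Similar 𝓘₁ 𝓘₂ =
  Σ (Members 𝓘₁ ⤖ Members 𝓘₂) λ ψ →
    ∀ X → ∣ proj₁ (Bijection.to ψ X) ∣ ≡ ∣ proj₁ X ∣

-- Every member of 𝓘 lies in exactly one activity interval [B ─ a B , B], and such an interval
-- contains exactly ∣ a B ∣ C j sets of size r - j. So the number of members of size r - j is
-- ∑ᵢ aᵢ · (i C j), a quantity that similarity preserves. This binomial transform is triangular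
-- with unit diagonal, so it determines the activity vector.
module Submission where

open import Defs
open import Data.Nat using (ℕ; zero; suc; _+_; _*_; _≤_; _<_; _≡ᵇ_; s≤s; s≤s⁻¹)
open import Data.Nat.Properties
open import Algebra.Properties.CommutativeSemigroup +-commutativeSemigroup using (interchange)
open import Data.Nat.Combinatorics using (_C_; nCn≡1; k>n⇒nCk≡0; nCk+nC[k+1]≡[n+1]C[k+1])
open import Data.Nat.ListAction using (sum)
open import Data.Nat.ListAction.Properties using (sum-++)
open import Data.Bool using (Bool; true; false; T; _∧_)
open import Data.Bool.Properties using (T-∧; T-irrelevant; ∧-zeroʳ)
open import Data.Fin using (Fin; toℕ)
import Data.Fin as Fin
open import Data.Fin.Properties using (+↔⊎; cantor-schröder-bernstein; toℕ<n)
open import Data.Fin.Subset using (Subset; _⊆_; _─_; ∣_∣; inside; outside)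
open import Data.Fin.Subset.Properties using (_⊆?_; drop-∷-⊆; p⊆q⇒∣p∣≤∣q∣)
open import Data.Vec using (_∷_; []; here)
open import Data.Vec.Properties using (∷-injectiveʳ)
open import Data.List using (List; []; _∷_; map; _++_; length; filterᵇ)
open import Data.List.Properties using (map-++; map-∘)
open import Data.Product using (Σ; proj₁; proj₂; _×_; _,_)
open import Data.Sum using (_⊎_; inj₁; inj₂)
open import Data.Sum.Function.Propositional using (_⊎-↔_)
open import Data.Empty using (⊥-elim)
open import Data.Unit using (tt)
open import Function using (_∘_)
open import Function.Bundles using (Bijection; Equivalence; Injection; Inverse; _↔_; mk↔ₛ′)
open import Function.Properties.Bijection using (⤖⇒↔)
open import Function.Properties.Inverse using (↔-trans; ↔-sym; ↔⇒↣)
open import Relation.Nullary using (¬_; yes; no; does)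
open import Relation.Nullary.Decidable using (toWitness; fromWitness; isYes≗does)
open import Relation.Binary.PropositionalEquality
open import Relation.Binary.Definitions using (tri<; tri≈; tri>)

𝟙 : Bool → ℕ
𝟙 true  = 1
𝟙 false = 0

𝟙-∧ : ∀ x y → 𝟙 (x ∧ y) ≡ 𝟙 x * 𝟙 y
𝟙-∧ true  y = sym (+-identityʳ (𝟙 y))
𝟙-∧ false y = refl

𝟙-true : ∀ {x} → T x → 𝟙 x ≡ 1
𝟙-true {true} _ = refl

𝟙-false : ∀ {x} → ¬ T x → 𝟙 x ≡ 0
𝟙-false {true}  ¬x = ⊥-elim (¬x tt)
𝟙-false {false} _  = refl

𝟙*𝟙-disjoint : ∀ x y → (T x → ¬ T y) → 𝟙 x * 𝟙 y ≡ 0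
𝟙*𝟙-disjoint x y disj = trans (sym (𝟙-∧ x y)) (𝟙-false λ x∧y →
  disj (proj₁ (Equivalence.to T-∧ x∧y)) (proj₂ (Equivalence.to T-∧ x∧y)))

∑< : ℕ → (ℕ → ℕ) → ℕ
∑< zero    f = 0
∑< (suc k) f = ∑< k f + f k

∑<-cong : ∀ k {f g : ℕ → ℕ} → (∀ i → i < k → f i ≡ g i) → ∑< k f ≡ ∑< k g
∑<-cong zero    f≗g = refl
∑<-cong (suc k) f≗g = cong₂ _+_ (∑<-cong k (λ i i<k → f≗g i (m<n⇒m<1+n i<k))) (f≗g k ≤-refl)

∑<-zero : ∀ k → ∑< k (λ _ → 0) ≡ 0
∑<-zero zero    = refl
∑<-zero (suc k) = trans (+-identityʳ _) (∑<-zero k)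

∑<-select : ∀ k {m} (h : ℕ → ℕ) → m < k → ∑< k (λ i → 𝟙 (m ≡ᵇ i) * h i) ≡ h m
∑<-select (suc k) {m} h m<1+k with m ≟ k
... | yes refl = begin
  ∑< m (λ i → 𝟙 (m ≡ᵇ i) * h i) + 𝟙 (m ≡ᵇ m) * h m
    ≡⟨ cong₂ _+_ (∑<-cong m λ i i<m → cong (_* h i) (𝟙-false λ m≡i → <-irrefl (sym (≡ᵇ⇒≡ m i m≡i)) i<m))
                 (cong (_* h m) (𝟙-true (≡⇒≡ᵇ m m refl))) ⟩
  ∑< m (λ _ → 0) + 1 * h m
    ≡⟨ cong₂ _+_ (∑<-zero m) (*-identityˡ (h m)) ⟩
  h m ∎
  where open ≡-Reasoning
... | no m≢k = begin
  ∑< k (λ i → 𝟙 (m ≡ᵇ i) * h i) + 𝟙 (m ≡ᵇ k) * h k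
    ≡⟨ cong₂ _+_ (∑<-select k h (≤∧≢⇒< (s≤s⁻¹ m<1+k) m≢k)) (cong (_* h k) (𝟙-false (m≢k ∘ ≡ᵇ⇒≡ m k))) ⟩
  h m + 0
    ≡⟨ +-identityʳ (h m) ⟩
  h m ∎
  where open ≡-Reasoning

∑<-cancel : ∀ k (f g : ℕ → ℕ) {i} → i < k → (∀ t → t < k → t ≢ i → f t ≡ g t) →
            ∑< k f ≡ ∑< k g → f i ≡ g i
∑<-cancel (suc k) f g {i} i<1+k f≗g sums≡ with k ≟ i
... | yes refl = +-cancelˡ-≡ (∑< k f) (f k) (g k) (trans sums≡ (cong (_+ g k) (sym lower≡)))
  where
  lower≡ : ∑< k f ≡ ∑< k g
  lower≡ = ∑<-cong k λ t t<k → f≗g t (m<n⇒m<1+n t<k) λ t≡k → <-irrefl t≡k t<k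
... | no k≢i = ∑<-cancel k f g (≤∧≢⇒< (s≤s⁻¹ i<1+k) (k≢i ∘ sym)) (λ t t<k → f≗g t (m<n⇒m<1+n t<k))
  (+-cancelʳ-≡ (f k) (∑< k f) (∑< k g) (trans sums≡ (cong (∑< k g +_) (sym (f≗g k ≤-refl k≢i)))))

binomialTransform-injective : ∀ k (A A' : ℕ → ℕ) →
  (∀ j → ∑< k (λ i → A i * (i C j)) ≡ ∑< k (λ i → A' i * (i C j))) →
  ∀ i → i < k → A i ≡ A' i
binomialTransform-injective k A A' transforms≡ i = agreeAbove k i (m≤m+n k i)
  where
  -- Downward induction on i (d bounds k - i): in the j = i equation, t C i vanishes for t < i and is 1 for t = i.
  agreeAbove : ∀ d i → k ≤ d + i → i < k → A i ≡ A' i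
  agreeAbove zero    i k≤i i<k = ⊥-elim (<-irrefl refl (<-≤-trans i<k k≤i))
  agreeAbove (suc d) i k≤1+d+i i<k = begin
    A i             ≡⟨ *-identityʳ (A i) ⟨
    A i * 1         ≡⟨ cong (A i *_) (nCn≡1 i) ⟨
    A i * (i C i)   ≡⟨ ∑<-cancel k (λ t → A t * (t C i)) (λ t → A' t * (t C i)) i<k others (transforms≡ i) ⟩
    A' i * (i C i)  ≡⟨ cong (A' i *_) (nCn≡1 i) ⟩
    A' i * 1        ≡⟨ *-identityʳ (A' i) ⟩
    A' i            ∎
    where
    open ≡-Reasoning
    others : ∀ t → t < k → t ≢ i → A t * (t C i) ≡ A' t * (t C i)
    others t t<k t≢i with <-cmp t i
    ... | tri< t<i _ _ = begin
      A t * (t C i)   ≡⟨ cong (A t *_) (k>n⇒nCk≡0 t<i) ⟩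
      A t * 0         ≡⟨ *-zeroʳ (A t) ⟩
      0               ≡⟨ *-zeroʳ (A' t) ⟨
      A' t * 0        ≡⟨ cong (A' t *_) (k>n⇒nCk≡0 t<i) ⟨
      A' t * (t C i)  ∎
    ... | tri≈ _ t≡i _ = ⊥-elim (t≢i t≡i)
    ... | tri> _ _ i<t = cong (_* (t C i)) (agreeAbove d t k≤d+t t<k)
      where
      k≤d+t : k ≤ d + t
      k≤d+t = ≤-trans k≤1+d+i (≤-trans (≤-reflexive (sym (+-suc d i))) (+-monoʳ-≤ d i<t))

∑ₛ : ∀ n → (Subset n → ℕ) → ℕ
∑ₛ zero    f = f []
∑ₛ (suc n) f = ∑ₛ n (f ∘ (inside ∷_)) + ∑ₛ n (f ∘ (outside ∷_))

∑ₛ-cong : ∀ n {f g : Subset n → ℕ} → (∀ X → f X ≡ g X) → ∑ₛ n f ≡ ∑ₛ n g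
∑ₛ-cong zero    f≗g = f≗g []
∑ₛ-cong (suc n) f≗g = cong₂ _+_ (∑ₛ-cong n (f≗g ∘ (inside ∷_))) (∑ₛ-cong n (f≗g ∘ (outside ∷_)))

∑ₛ-zero : ∀ n {f : Subset n → ℕ} → (∀ X → f X ≡ 0) → ∑ₛ n f ≡ 0
∑ₛ-zero n f≗0 = trans (∑ₛ-cong n f≗0) (const0 n)
  where
  const0 : ∀ n → ∑ₛ n (λ _ → 0) ≡ 0
  const0 zero    = refl
  const0 (suc n) = cong₂ _+_ (const0 n) (const0 n)

∑ₛ-single : ∀ n {f : Subset n → ℕ} X → (∀ Y → Y ≢ X → f Y ≡ 0) → ∑ₛ n f ≡ f X
∑ₛ-single zero    []            _ = refl
∑ₛ-single (suc n) (inside ∷ X)  f≗0 = trans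
  (cong₂ _+_ (∑ₛ-single n X λ Y Y≢X → f≗0 (inside ∷ Y) (Y≢X ∘ ∷-injectiveʳ))
             (∑ₛ-zero n λ Y → f≗0 (outside ∷ Y) λ ()))
  (+-identityʳ _)
∑ₛ-single (suc n) (outside ∷ X) f≗0 =
  cong₂ _+_ (∑ₛ-zero n λ Y → f≗0 (inside ∷ Y) λ ())
            (∑ₛ-single n X λ Y Y≢X → f≗0 (outside ∷ Y) (Y≢X ∘ ∷-injectiveʳ))

∑ₛ-+ : ∀ n (f g : Subset n → ℕ) → ∑ₛ n (λ X → f X + g X) ≡ ∑ₛ n f + ∑ₛ n g
∑ₛ-+ zero    f g = refl
∑ₛ-+ (suc n) f g = trans (cong₂ _+_ (∑ₛ-+ n _ _) (∑ₛ-+ n _ _))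
  (interchange (∑ₛ n (f ∘ (inside ∷_))) (∑ₛ n (g ∘ (inside ∷_))) (∑ₛ n (f ∘ (outside ∷_))) (∑ₛ n (g ∘ (outside ∷_))))

∑ₛ-*ʳ : ∀ n (f : Subset n → ℕ) c → ∑ₛ n (λ X → f X * c) ≡ ∑ₛ n f * c
∑ₛ-*ʳ zero    f c = refl
∑ₛ-*ʳ (suc n) f c = trans (cong₂ _+_ (∑ₛ-*ʳ n _ c) (∑ₛ-*ʳ n _ c)) (sym (*-distribʳ-+ c (∑ₛ n _) _))

∑ₛ-comm : ∀ n m (g : Subset n → Subset m → ℕ) → ∑ₛ n (λ X → ∑ₛ m (g X)) ≡ ∑ₛ m (λ Y → ∑ₛ n (λ X → g X Y))
∑ₛ-comm zero    m g = refl
∑ₛ-comm (suc n) m g = trans (cong₂ _+_ (∑ₛ-comm n m _) (∑ₛ-comm n m _)) (sym (∑ₛ-+ m _ _))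

∑ₛ-∑<-comm : ∀ n k (g : Subset n → ℕ → ℕ) → ∑ₛ n (λ X → ∑< k (g X)) ≡ ∑< k (λ i → ∑ₛ n (λ X → g X i))
∑ₛ-∑<-comm n zero    g = ∑ₛ-zero n λ _ → refl
∑ₛ-∑<-comm n (suc k) g = trans (∑ₛ-+ n _ _) (cong (_+ ∑ₛ n (λ X → g X k)) (∑ₛ-∑<-comm n k g))

length-filterᵇ : ∀ {A : Set} (p : A → Bool) xs → length (filterᵇ p xs) ≡ sum (map (𝟙 ∘ p) xs)
length-filterᵇ p []       = refl
length-filterᵇ p (x ∷ xs) with p x
... | true  = cong suc (length-filterᵇ p xs)
... | false = length-filterᵇ p xs

sum-allSubsets : ∀ n (f : Subset n → ℕ) → sum (map f (allSubsets n)) ≡ ∑ₛ n f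
sum-allSubsets zero    f = +-identityʳ (f [])
sum-allSubsets (suc n) f = begin
  sum (map f (ins ++ outs))                                    ≡⟨ cong sum (map-++ f ins outs) ⟩
  sum (map f ins ++ map f outs)                                ≡⟨ sum-++ (map f ins) (map f outs) ⟩
  sum (map f ins) + sum (map f outs)                           ≡⟨ cong₂ _+_ (cong sum (sym (map-∘ (allSubsets n))))
                                                                            (cong sum (sym (map-∘ (allSubsets n)))) ⟩
  sum (map (f ∘ (inside ∷_)) (allSubsets n))
    + sum (map (f ∘ (outside ∷_)) (allSubsets n))              ≡⟨ cong₂ _+_ (sum-allSubsets n _) (sum-allSubsets n _) ⟩
  ∑ₛ (suc n) f                                                 ∎
  where
  open ≡-Reasoning
  ins outs : List (Subset (suc n))
  ins  = map (inside ∷_) (allSubsets n)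
  outs = map (outside ∷_) (allSubsets n)

activityCount≡∑ₛ : ∀ r {n} (𝓘 : Collection n) a i →
  activityCount r 𝓘 a i ≡ ∑ₛ n (λ B → 𝟙 (isBasisᵇ r 𝓘 B ∧ (∣ a B ∣ ≡ᵇ i)))
activityCount≡∑ₛ r {n} 𝓘 a i = trans (length-filterᵇ _ (allSubsets n)) (sum-allSubsets n _)

T↔Fin𝟙 : ∀ b → T b ↔ Fin (𝟙 b)
T↔Fin𝟙 true  = mk↔ₛ′ (λ _ → Fin.zero) (λ _ → tt) (λ { Fin.zero → refl ; (Fin.suc ()) }) (λ _ → refl)
T↔Fin𝟙 false = mk↔ₛ′ (λ ()) (λ ()) (λ ()) (λ ())

Σ-Subset-suc↔⊎ : ∀ n (P : Subset (suc n) → Set) →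
  Σ (Subset (suc n)) P ↔ (Σ (Subset n) (P ∘ (inside ∷_)) ⊎ Σ (Subset n) (P ∘ (outside ∷_)))
Σ-Subset-suc↔⊎ n P = mk↔ₛ′ split join
  (λ { (inj₁ _) → refl ; (inj₂ _) → refl })
  (λ { (inside ∷ X , p) → refl ; (outside ∷ X , p) → refl })
  where
  split : Σ (Subset (suc n)) P → Σ (Subset n) (P ∘ (inside ∷_)) ⊎ Σ (Subset n) (P ∘ (outside ∷_))
  split (inside  ∷ X , p) = inj₁ (X , p)
  split (outside ∷ X , p) = inj₂ (X , p)
  join : Σ (Subset n) (P ∘ (inside ∷_)) ⊎ Σ (Subset n) (P ∘ (outside ∷_)) → Σ (Subset (suc n)) P
  join (inj₁ (X , p)) = inside ∷ X , p
  join (inj₂ (X , p)) = outside ∷ X , p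

Σ-T↔Fin∑ₛ : ∀ n (P : Subset n → Bool) → Σ (Subset n) (T ∘ P) ↔ Fin (∑ₛ n (𝟙 ∘ P))
Σ-T↔Fin∑ₛ zero    P = ↔-trans (mk↔ₛ′ (λ { ([] , p) → p }) ([] ,_) (λ _ → refl) (λ { ([] , _) → refl })) (T↔Fin𝟙 (P []))
Σ-T↔Fin∑ₛ (suc n) P = ↔-trans (Σ-Subset-suc↔⊎ n (T ∘ P))
  (↔-trans (Σ-T↔Fin∑ₛ n _ ⊎-↔ Σ-T↔Fin∑ₛ n _) (↔-sym +↔⊎))

↔⇒∑ₛ≡ : ∀ n (P P' : Subset n → Bool) → Σ (Subset n) (T ∘ P) ↔ Σ (Subset n) (T ∘ P') →
        ∑ₛ n (𝟙 ∘ P) ≡ ∑ₛ n (𝟙 ∘ P')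
↔⇒∑ₛ≡ n P P' ψ = cantor-schröder-bernstein (Injection.injective (↔⇒↣ fins)) (Injection.injective (↔⇒↣ (↔-sym fins)))
  where
  fins : Fin (∑ₛ n (𝟙 ∘ P)) ↔ Fin (∑ₛ n (𝟙 ∘ P'))
  fins = ↔-trans (↔-sym (Σ-T↔Fin∑ₛ n P)) (↔-trans ψ (Σ-T↔Fin∑ₛ n P'))

Σ-T-≡ : ∀ {A : Set} {P : A → Bool} {u v : Σ A (T ∘ P)} → proj₁ u ≡ proj₁ v → u ≡ v
Σ-T-≡ {u = x , p} {v = .x , q} refl = cong (x ,_) (T-irrelevant p q)

↔-restrict : ∀ {A : Set} {P P' : A → Bool} (Q : A → Bool) (ψ : Σ A (T ∘ P) ↔ Σ A (T ∘ P')) →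
  (∀ x → Q (proj₁ (Inverse.to ψ x)) ≡ Q (proj₁ x)) →
  Σ A (λ x → T (P x ∧ Q x)) ↔ Σ A (λ x → T (P' x ∧ Q x))
↔-restrict {A} Q ψ Q-pres = mk↔ₛ′ (restrict ψ→ Q-pres) (restrict ψ← Q-pres⁻)
  (λ (y , _) → Σ-T-≡ (trans (cong (proj₁ ∘ ψ→) (Σ-T-≡ refl)) (cong proj₁ (strictlyInverseˡ (y , _)))))
  (λ (x , _) → Σ-T-≡ (trans (cong (proj₁ ∘ ψ←) (Σ-T-≡ refl)) (cong proj₁ (strictlyInverseʳ (x , _)))))
  where
  open Inverse ψ renaming (to to ψ→; from to ψ←)

  Q-pres⁻ : ∀ y → Q (proj₁ (ψ← y)) ≡ Q (proj₁ y)
  Q-pres⁻ y = trans (sym (Q-pres (ψ← y))) (cong (Q ∘ proj₁) (strictlyInverseˡ y))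

  restrict : ∀ {R R' : A → Bool} (f : Σ A (T ∘ R) → Σ A (T ∘ R')) → (∀ x → Q (proj₁ (f x)) ≡ Q (proj₁ x)) →
             Σ A (λ x → T (R x ∧ Q x)) → Σ A (λ x → T (R' x ∧ Q x))
  restrict f pres (x , rq) = proj₁ y , Equivalence.from T-∧ (proj₂ y , subst T (sym (pres (x , r))) q)
    where
    r = proj₁ (Equivalence.to T-∧ rq)
    q = proj₂ (Equivalence.to T-∧ rq)
    y = f (x , r)

sizeCount : ∀ {n} → Collection n → (ℕ → Bool) → ℕ
sizeCount {n} 𝓘 q = ∑ₛ n (λ X → 𝟙 (𝓘 X ∧ q ∣ X ∣))

similar⇒sizeCount≡ : ∀ {n} (𝓘 𝓘' : Collection n) → Similar 𝓘 𝓘' → (q : ℕ → Bool) →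
  sizeCount 𝓘 q ≡ sizeCount 𝓘' q
similar⇒sizeCount≡ {n} 𝓘 𝓘' (ψ , size-pres) q =
  ↔⇒∑ₛ≡ n _ _ (↔-restrict (q ∘ ∣_∣) (⤖⇒↔ ψ) (cong q ∘ size-pres))

_⊆ᵇ_ : ∀ {n} → Subset n → Subset n → Bool
X ⊆ᵇ Y = does (X ⊆? Y)

⊆ᵇ⇒⊆ : ∀ {n} {X Y : Subset n} → T (X ⊆ᵇ Y) → X ⊆ Y
⊆ᵇ⇒⊆ {X = X} {Y} = toWitness ∘ subst T (sym (isYes≗does (X ⊆? Y)))

⊆⇒⊆ᵇ : ∀ {n} {X Y : Subset n} → X ⊆ Y → T (X ⊆ᵇ Y)
⊆⇒⊆ᵇ {X = X} {Y} = subst T (isYes≗does (X ⊆? Y)) ∘ fromWitness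

intervalSizeCount : ∀ {n} (B A : Subset n) j → A ⊆ B →
  ∑ₛ n (λ I → 𝟙 ((B ─ A) ⊆ᵇ I ∧ I ⊆ᵇ B) * 𝟙 (∣ I ∣ + j ≡ᵇ ∣ B ∣)) ≡ ∣ A ∣ C j
intervalSizeCount []            []            zero    _   = refl
intervalSizeCount []            []            (suc j) _   = refl
intervalSizeCount {suc n} (inside ∷ B) (inside ∷ A) j A⊆B =
  trans (cong (_+ ∑ₛ n (λ I → 𝟙 (inInterval I) * 𝟙 (∣ I ∣ + j ≡ᵇ suc ∣ B ∣)))
              (intervalSizeCount B A j (drop-∷-⊆ A⊆B)))
        (pascal j)
  where
  inInterval : Subset n → Bool
  inInterval I = (B ─ A) ⊆ᵇ I ∧ I ⊆ᵇ B

  tooLarge : ∀ I → T (inInterval I) → ¬ T (∣ I ∣ + 0 ≡ᵇ suc ∣ B ∣)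
  tooLarge I inI eq = 1+n≰n (begin
    suc ∣ B ∣  ≡⟨ ≡ᵇ⇒≡ (∣ I ∣ + 0) (suc ∣ B ∣) eq ⟨
    ∣ I ∣ + 0  ≡⟨ +-identityʳ ∣ I ∣ ⟩
    ∣ I ∣      ≤⟨ p⊆q⇒∣p∣≤∣q∣ (⊆ᵇ⇒⊆ {X = I} {B} (proj₂ (Equivalence.to (T-∧ {(B ─ A) ⊆ᵇ I}) inI))) ⟩
    ∣ B ∣      ∎)
    where open ≤-Reasoning

  -- The sets I avoiding the new element of A are counted by ∣ A ∣ C (j - 1).
  pascal : ∀ j → ∣ A ∣ C j + ∑ₛ n (λ I → 𝟙 (inInterval I) * 𝟙 (∣ I ∣ + j ≡ᵇ suc ∣ B ∣)) ≡ suc ∣ A ∣ C j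
  pascal zero = begin
    ∣ A ∣ C 0 + ∑ₛ n (λ I → 𝟙 (inInterval I) * 𝟙 (∣ I ∣ + 0 ≡ᵇ suc ∣ B ∣))
      ≡⟨ cong (∣ A ∣ C 0 +_) (∑ₛ-zero n λ I → 𝟙*𝟙-disjoint (inInterval I) _ (tooLarge I)) ⟩
    ∣ A ∣ C 0 + 0
      ≡⟨ +-identityʳ _ ⟩
    suc ∣ A ∣ C 0 ∎
    where open ≡-Reasoning
  pascal (suc j) = begin
    ∣ A ∣ C suc j + ∑ₛ n (λ I → 𝟙 (inInterval I) * 𝟙 (∣ I ∣ + suc j ≡ᵇ suc ∣ B ∣))
      ≡⟨ cong (∣ A ∣ C suc j +_) (∑ₛ-cong n λ I → cong (λ m → 𝟙 (inInterval I) * 𝟙 (m ≡ᵇ suc ∣ B ∣)) (+-suc ∣ I ∣ j)) ⟩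
    ∣ A ∣ C suc j + ∑ₛ n (λ I → 𝟙 (inInterval I) * 𝟙 (∣ I ∣ + j ≡ᵇ ∣ B ∣))
      ≡⟨ cong (∣ A ∣ C suc j +_) (intervalSizeCount B A j (drop-∷-⊆ A⊆B)) ⟩
    ∣ A ∣ C suc j + ∣ A ∣ C j
      ≡⟨ +-comm (∣ A ∣ C suc j) _ ⟩
    ∣ A ∣ C j + ∣ A ∣ C suc j
      ≡⟨ nCk+nC[k+1]≡[n+1]C[k+1] ∣ A ∣ j ⟩
    suc ∣ A ∣ C suc j ∎
    where open ≡-Reasoning
intervalSizeCount {suc n} (inside ∷ B) (outside ∷ A) j A⊆B =
  trans (cong₂ _+_ (intervalSizeCount B A j (drop-∷-⊆ A⊆B)) (∑ₛ-zero n λ _ → refl)) (+-identityʳ _)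
intervalSizeCount {suc n} (outside ∷ B) (outside ∷ A) j A⊆B =
  cong₂ _+_ (∑ₛ-zero n λ I → cong (λ b → 𝟙 b * 𝟙 (suc ∣ I ∣ + j ≡ᵇ ∣ B ∣)) (∧-zeroʳ ((B ─ A) ⊆ᵇ I)))
            (intervalSizeCount B A j (drop-∷-⊆ A⊆B))
intervalSizeCount (outside ∷ B) (inside ∷ A) j A⊆B with A⊆B here
... | ()

module _ {n} (r : ℕ) (𝓘 : Collection n) (a : Subset n → Subset n) (act : IsActivity r 𝓘 a) where
  open IsActivity act

  isBasisᵇ⇒IsBasis : ∀ {B} → T (isBasisᵇ r 𝓘 B) → IsBasis r 𝓘 B
  isBasisᵇ⇒IsBasis {B} isB = proj₁ B∈𝓘∧∣B∣≡r , ≡ᵇ⇒≡ ∣ B ∣ r (proj₂ B∈𝓘∧∣B∣≡r)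
    where B∈𝓘∧∣B∣≡r = Equivalence.to (T-∧ {𝓘 B}) isB

  IsBasis⇒isBasisᵇ : ∀ {B} → IsBasis r 𝓘 B → T (isBasisᵇ r 𝓘 B)
  IsBasis⇒isBasisᵇ {B} (B∈𝓘 , ∣B∣≡r) = Equivalence.from (T-∧ {𝓘 B}) (B∈𝓘 , ≡⇒≡ᵇ ∣ B ∣ r ∣B∣≡r)

  inActivityInterval : Subset n → Subset n → Bool
  inActivityInterval B I = isBasisᵇ r 𝓘 B ∧ ((B ─ a B) ⊆ᵇ I ∧ I ⊆ᵇ B)

  inActivityInterval⇒ : ∀ {B I} → T (inActivityInterval B I) → IsBasis r 𝓘 B × I ∈[ B ─ a B , B ]
  inActivityInterval⇒ {B} inI = isBasisᵇ⇒IsBasis (proj₁ isB∧I∈) , ⊆ᵇ⇒⊆ (proj₁ I∈) , ⊆ᵇ⇒⊆ (proj₂ I∈)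
    where
    isB∧I∈ = Equivalence.to (T-∧ {isBasisᵇ r 𝓘 B}) inI
    I∈ = Equivalence.to T-∧ (proj₂ isB∧I∈)

  ⇒inActivityInterval : ∀ {B I} → IsBasis r 𝓘 B → I ∈[ B ─ a B , B ] → T (inActivityInterval B I)
  ⇒inActivityInterval isB (lower , upper) =
    Equivalence.from T-∧ (IsBasis⇒isBasisᵇ isB , Equivalence.from T-∧ (⊆⇒⊆ᵇ lower , ⊆⇒⊆ᵇ upper))

  activityIntervals-partition : ∀ I → ∑ₛ n (λ B → 𝟙 (inActivityInterval B I)) ≡ 𝟙 (𝓘 I)
  activityIntervals-partition I with 𝓘 I in I∈𝓘
  ... | false = ∑ₛ-zero n λ B → 𝟙-false λ inI →
    subst T I∈𝓘 (interval B (proj₁ (inActivityInterval⇒ inI)) I (proj₂ (inActivityInterval⇒ inI)))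
  ... | true with unique I (subst T (sym I∈𝓘) tt)
  ...   | B₀ , isB₀ , I∈₀ , onlyB₀ = trans
    (∑ₛ-single n B₀ λ B B≢B₀ → 𝟙-false λ inI →
      B≢B₀ (onlyB₀ B (proj₁ (inActivityInterval⇒ inI)) (proj₂ (inActivityInterval⇒ inI))))
    (𝟙-true (⇒inActivityInterval isB₀ I∈₀))

  basisContribution : ∀ j B →
    ∑ₛ n (λ I → 𝟙 (inActivityInterval B I) * 𝟙 (∣ I ∣ + j ≡ᵇ r))
      ≡ ∑< (suc r) (λ i → 𝟙 (isBasisᵇ r 𝓘 B ∧ (∣ a B ∣ ≡ᵇ i)) * (i C j))
  basisContribution j B with isBasisᵇ r 𝓘 B in isB
  ... | false = trans (∑ₛ-zero n λ _ → refl) (sym (∑<-zero (suc r)))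
  ... | true = begin
    ∑ₛ n (λ I → 𝟙 ((B ─ a B) ⊆ᵇ I ∧ I ⊆ᵇ B) * 𝟙 (∣ I ∣ + j ≡ᵇ r))
      ≡⟨ ∑ₛ-cong n (λ I → cong (λ m → 𝟙 ((B ─ a B) ⊆ᵇ I ∧ I ⊆ᵇ B) * 𝟙 (∣ I ∣ + j ≡ᵇ m)) (sym ∣B∣≡r)) ⟩
    ∑ₛ n (λ I → 𝟙 ((B ─ a B) ⊆ᵇ I ∧ I ⊆ᵇ B) * 𝟙 (∣ I ∣ + j ≡ᵇ ∣ B ∣))
      ≡⟨ intervalSizeCount B (a B) j (sub B basis) ⟩
    ∣ a B ∣ C j
      ≡⟨ ∑<-select (suc r) (_C j) (s≤s (≤-trans (p⊆q⇒∣p∣≤∣q∣ (sub B basis)) (≤-reflexive ∣B∣≡r))) ⟨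
    ∑< (suc r) (λ i → 𝟙 (∣ a B ∣ ≡ᵇ i) * (i C j)) ∎
    where
    open ≡-Reasoning
    basis = isBasisᵇ⇒IsBasis (subst T (sym isB) tt)
    ∣B∣≡r = proj₂ basis

  sizeCount≡∑<activityCount : ∀ j →
    sizeCount 𝓘 (λ s → s + j ≡ᵇ r) ≡ ∑< (suc r) (λ i → activityCount r 𝓘 a i * (i C j))
  sizeCount≡∑<activityCount j = begin
    ∑ₛ n (λ I → 𝟙 (𝓘 I ∧ c I))
      ≡⟨ ∑ₛ-cong n (λ I → 𝟙-∧ (𝓘 I) (c I)) ⟩
    ∑ₛ n (λ I → 𝟙 (𝓘 I) * 𝟙 (c I))
      ≡⟨ ∑ₛ-cong n (λ I → cong (_* 𝟙 (c I)) (activityIntervals-partition I)) ⟨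
    ∑ₛ n (λ I → ∑ₛ n (λ B → 𝟙 (inActivityInterval B I)) * 𝟙 (c I))
      ≡⟨ ∑ₛ-cong n (λ I → ∑ₛ-*ʳ n (λ B → 𝟙 (inActivityInterval B I)) (𝟙 (c I))) ⟨
    ∑ₛ n (λ I → ∑ₛ n (λ B → 𝟙 (inActivityInterval B I) * 𝟙 (c I)))
      ≡⟨ ∑ₛ-comm n n _ ⟩
    ∑ₛ n (λ B → ∑ₛ n (λ I → 𝟙 (inActivityInterval B I) * 𝟙 (c I)))
      ≡⟨ ∑ₛ-cong n (basisContribution j) ⟩
    ∑ₛ n (λ B → ∑< (suc r) (λ i → 𝟙 (isBasisᵇ r 𝓘 B ∧ (∣ a B ∣ ≡ᵇ i)) * (i C j)))
      ≡⟨ ∑ₛ-∑<-comm n (suc r) _ ⟩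
    ∑< (suc r) (λ i → ∑ₛ n (λ B → 𝟙 (isBasisᵇ r 𝓘 B ∧ (∣ a B ∣ ≡ᵇ i)) * (i C j)))
      ≡⟨ ∑<-cong (suc r) (λ i _ → trans (∑ₛ-*ʳ n _ (i C j)) (cong (_* (i C j)) (sym (activityCount≡∑ₛ r 𝓘 a i)))) ⟩
    ∑< (suc r) (λ i → activityCount r 𝓘 a i * (i C j)) ∎
    where
    open ≡-Reasoning
    c : Subset n → Bool
    c I = ∣ I ∣ + j ≡ᵇ r

theorem3p5 : (r n : ℕ) (𝓘 𝓘' : Collection n)
    (a a' : Subset n → Subset n) →
    IsCoveringSystem r 𝓘 → IsCoveringSystem r 𝓘' →
    Similar 𝓘 𝓘' →
    IsActivity r 𝓘 a → IsActivity r 𝓘' a' →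
    (i : Fin (suc r)) → activityCount r 𝓘 a (toℕ i) ≡ activityCount r 𝓘' a' (toℕ i)
theorem3p5 r n 𝓘 𝓘' a a' _ _ similar act act' i =
  binomialTransform-injective (suc r) (activityCount r 𝓘 a) (activityCount r 𝓘' a') transforms≡ (toℕ i) (toℕ<n i)
  where
  transforms≡ : ∀ j → ∑< (suc r) (λ i → activityCount r 𝓘 a i * (i C j))
                    ≡ ∑< (suc r) (λ i → activityCount r 𝓘' a' i * (i C j))
  transforms≡ j = begin
    ∑< (suc r) (λ i → activityCount r 𝓘 a i * (i C j))    ≡⟨ sizeCount≡∑<activityCount r 𝓘 a act j ⟨
    sizeCount 𝓘 (λ s → s + j ≡ᵇ r)                        ≡⟨ similar⇒sizeCount≡ 𝓘 𝓘' similar (λ s → s + j ≡ᵇ r) ⟩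
    sizeCount 𝓘' (λ s → s + j ≡ᵇ r)                       ≡⟨ sizeCount≡∑<activityCount r 𝓘' a' act' j ⟩
    ∑< (suc r) (λ i → activityCount r 𝓘' a' i * (i C j))  ∎
    where open ≡-Reasoning
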